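{- Let $\mathcal{C}$ be a full comprehension category satisfying condition (LF). If $\mathcal{C}$ has weakly stable dependent sums, then the split comprehension category $\mathcal{C}_!$ has strictly stable dependent sums.
   Context: A full comprehension category $\mathcal{C}=(\mathcal{C},\mathcal{T},p,\chi)$: a category $\mathcal{C}$, a cloven Grothendieck fibration $p:\mathcal{T}\to\mathcal{C}$, a fully faithful functor $\chi:\mathcal{T}\to\mathcal{C}^{\to}$ with $\mathrm{cod}\circ\chi=p$ sending cartesian arrows to pullback squares; split if the cleaving is strictly functorial. For $A\in\mathcal{T}(\Gamma)$, $\chi(A):\Gamma.A\to\Gamma$; display maps are composites of these. For $\sigma:\Delta\to\Gamma$, $A[\sigma]$ is the cleaving's reindexing; $f[\sigma]$ the induced reindexing of a map (maps in fibres identified with maps over the base via $\chi$). A section of $A$ is a section of $\chi(A)$. Condition (LF): $\mathcal{C}$ has finite products, and for all $Z\xrightarrow{g}Y\xrightarrow{f}X$ with $f$ a display map and $g$ a display map or product projection, a dependent exponential exists (an object $\prod[f,g]$ of $\mathcal{C}/X$ with $\mathcal{C}/X(W,\prod[f,g])\cong\mathcal{C}/Y(W\times_XY,Z)$ naturally in $W\to X$). $\mathcal{C}_!$: same base; objects of $\mathcal{T}_!$ over $\Gamma$ are triples $A=(V_A,E_A,n_A)$, $V_A\in\mathcal{C}$, $E_A\in\mathcal{T}(V_A)$, $n_A:\Gamma\to V_A$, with $[A]:=E_A[n_A]$; morphisms $B\to A$ over $\sigma$ are morphisms $[B]\to[A]$ over $\sigma$ in $\mathcal{T}$; $(V_A,E_A,n_A)[\sigma]:=(V_A,E_A,n_A\circ\sigma)$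 with the canonical cartesian map; $\chi_!(A):=\chi([A])$. Dependent sum for $A\in\mathcal{T}(\Gamma)$, $B\in\mathcal{T}(\Gamma.A)$: $\Sigma_AB\in\mathcal{T}(\Gamma)$ and a map $\mathrm{pair}:\Gamma.A.B\to\Gamma.\Sigma_AB$ over $\Gamma$ such that for any $C\in\mathcal{T}(\Gamma.\Sigma_AB)$ and section $d:\Gamma.A.B\to\Gamma.A.B.C[\mathrm{pair}]$ there is a section $\mathrm{split}_{C,d}$ of $C$ with $\mathrm{split}_{C,d}\circ\mathrm{pair}=(\mathrm{pair}.C)\circ d$. Weakly stable dependent sums: for each $\Gamma,A,B$ there is $(\Sigma_AB,\mathrm{pair})$ such that for every $\sigma:\Delta\to\Gamma$, $(\Sigma_AB[\sigma],\mathrm{pair}[\sigma])$ is a dependent sum for $A[\sigma],B[\sigma]$. Strictly stable dependent sums (split case): functions choosing $(\Sigma_AB,\mathrm{pair})$ and sections $\mathrm{split}_{C,d}$, all commuting on the nose with reindexing. -}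

module Defs where

open import Level using (Level; _⊔_) renaming (suc to lsuc)
open import Data.Unit using (⊤)
open import Data.Product using (Σ; _,_; proj₁; proj₂; _×_; Σ-syntax)
open import Relation.Binary.PropositionalEquality
  using (_≡_; refl; sym; trans; cong; cong₂; subst; module ≡-Reasoning)

record Unique {a b} (A : Set a) (P : A → Set b) : Set (a ⊔ b) where
  constructor unique-intro
  field
    witness : A
    has     : P witness
    unique  : ∀ y → P y → y ≡ witness
open Unique public

record Category (o ℓ : Level) : Set (lsuc (o ⊔ ℓ)) where
  infixr 9 _∘_
  field
    Obj : Set o
    Hom : Obj → Obj → Set ℓ
    id  : ∀ {A} → Hom A A
    _∘_ : ∀ {A B C} → Hom B C → Hom A B → Hom A C
    identityˡ : ∀ {A B} {f : Hom A B} → id ∘ f ≡ f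
    identityʳ : ∀ {A B} {f : Hom A B} → f ∘ id ≡ f
    assoc : ∀ {A B C D} {f : Hom A B} {g : Hom B C} {h : Hom C D}
          → (h ∘ g) ∘ f ≡ h ∘ (g ∘ f)

module CategoryNotions {o ℓ} (C : Category o ℓ) where
  open Category C

  IsPullback : ∀ {P X Y Z} (f : Hom X Z) (g : Hom Y Z) (p₁ : Hom P X) (p₂ : Hom P Y)
             → Set (o ⊔ ℓ)
  IsPullback {P} f g p₁ p₂ =
    (f ∘ p₁ ≡ g ∘ p₂) ×
    (∀ {W} (h : Hom W _) (k : Hom W _) → f ∘ h ≡ g ∘ k
       → Unique (Hom W P) (λ u → (p₁ ∘ u ≡ h) × (p₂ ∘ u ≡ k)))

  IsProduct : ∀ {P X Y} (p₁ : Hom P X) (p₂ : Hom P Y) → Set (o ⊔ ℓ)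
  IsProduct {P} {X} {Y} p₁ p₂ =
    ∀ {W} (h : Hom W X) (k : Hom W Y)
    → Unique (Hom W P) (λ u → (p₁ ∘ u ≡ h) × (p₂ ∘ u ≡ k))

  IsTerminal : Obj → Set (o ⊔ ℓ)
  IsTerminal T = ∀ X → Unique (Hom X T) (λ _ → ⊤)

  record FiniteProducts : Set (o ⊔ ℓ) where
    field
      terminal    : Obj
      terminal-is : IsTerminal terminal
      prod        : Obj → Obj → Obj
      π₁          : ∀ {X Y} → Hom (prod X Y) X
      π₂          : ∀ {X Y} → Hom (prod X Y) Y
      prod-is     : ∀ {X Y} → IsProduct (π₁ {X} {Y}) (π₂ {X} {Y})

  IsProductProjection : ∀ {Z Y} → Hom Z Y → Set (o ⊔ ℓ)
  IsProductProjection {Z} g = Σ[ W ∈ Obj ] Σ[ g' ∈ Hom Z W ] IsProduct g g'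

  -- Dependent exponential Π[f,g] for Z --g--> Y --f--> X, as an object
  -- (Π, π : Π → X) of C/X representing  W ↦ C/Y(W ×_X Y, Z):
  -- given by its universal element ev : Π ×_X Y → Z (Yoneda).
  record DepExp {X Y Z} (f : Hom Y X) (g : Hom Z Y) : Set (o ⊔ ℓ) where
    field
      Π    : Obj
      π    : Hom Π X
      P'   : Obj
      e₁   : Hom P' Π
      e₂   : Hom P' Y
      e-pb : IsPullback π f e₁ e₂
      ev   : Hom P' Z
      ev-over : g ∘ ev ≡ e₂
      universal : ∀ {W W'} (w : Hom W X) (a : Hom W' W) (b : Hom W' Y)
        → IsPullback w f a b
        → (h : Hom W' Z) → g ∘ h ≡ b
        → Unique (Hom W Π)
            (λ k → (π ∘ k ≡ w) ×
                   (∀ (m : Hom W' P') → e₁ ∘ m ≡ k ∘ a → e₂ ∘ m ≡ b → ev ∘ m ≡ h))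

-- Cloven Grothendieck fibrations, presented as displayed categories

record Displayed {o ℓ} (C : Category o ℓ) (t h : Level) : Set (o ⊔ ℓ ⊔ lsuc (t ⊔ h)) where
  open Category C
  infixr 9 _∘'_
  field
    Ob[_]  : Obj → Set t
    Hom[_] : ∀ {Δ Γ} → Hom Δ Γ → Ob[ Δ ] → Ob[ Γ ] → Set h
    id'    : ∀ {Γ} {A : Ob[ Γ ]} → Hom[ id ] A A
    _∘'_   : ∀ {Θ Δ Γ} {σ : Hom Δ Γ} {τ : Hom Θ Δ} {A : Ob[ Γ ]} {B : Ob[ Δ ]} {C : Ob[ Θ ]}
           → Hom[ σ ] B A → Hom[ τ ] C B → Hom[ σ ∘ τ ] C A
    identityˡ' : ∀ {Δ Γ} {σ : Hom Δ Γ} {A B} {f : Hom[ σ ] B A}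
               → subst (λ s → Hom[ s ] B A) identityˡ (id' ∘' f) ≡ f
    identityʳ' : ∀ {Δ Γ} {σ : Hom Δ Γ} {A B} {f : Hom[ σ ] B A}
               → subst (λ s → Hom[ s ] B A) identityʳ (f ∘' id') ≡ f
    assoc' : ∀ {Ξ Θ Δ Γ} {ρ : Hom Ξ Θ} {τ : Hom Θ Δ} {σ : Hom Δ Γ}
               {A : Ob[ Γ ]} {B : Ob[ Δ ]} {C : Ob[ Θ ]} {D : Ob[ Ξ ]}
               {f : Hom[ ρ ] D C} {g : Hom[ τ ] C B} {k : Hom[ σ ] B A}
           → subst (λ s → Hom[ s ] D A) assoc ((k ∘' g) ∘' f) ≡ k ∘' (g ∘' f)

  IsCartesian : ∀ {Δ Γ} {σ : Hom Δ Γ} {B : Ob[ Δ ]} {A : Ob[ Γ ]}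
              → Hom[ σ ] B A → Set (o ⊔ ℓ ⊔ t ⊔ h)
  IsCartesian {Δ} {Γ} {σ} {B} {A} f =
    ∀ {Θ} (τ : Hom Θ Δ) {C : Ob[ Θ ]} (g : Hom[ σ ∘ τ ] C A)
    → Unique (Hom[ τ ] C B) (λ k → f ∘' k ≡ g)

  record Cleaving : Set (o ⊔ ℓ ⊔ t ⊔ h) where
    field
      _[_]   : ∀ {Δ Γ} → Ob[ Γ ] → Hom Δ Γ → Ob[ Δ ]
      lift   : ∀ {Δ Γ} (σ : Hom Δ Γ) (A : Ob[ Γ ]) → Hom[ σ ] (A [ σ ]) A
      lift-cartesian : ∀ {Δ Γ} (σ : Hom Δ Γ) (A : Ob[ Γ ]) → IsCartesian (lift σ A)

record FullComprehensionCategory (o ℓ t h : Level) : Set (lsuc (o ⊔ ℓ ⊔ t ⊔ h)) where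
  field
    C        : Category o ℓ
    T        : Displayed C t h
    cleaving : Displayed.Cleaving T
  open Category C
  open CategoryNotions C
  open Displayed T
  open Cleaving cleaving
  infixl 5 _∙_
  field
    -- χ : T → C^→ with cod ∘ χ = p :   χ(A) = p A : Γ.A → Γ
    _∙_  : (Γ : Obj) → Ob[ Γ ] → Obj
    pr   : ∀ {Γ} (A : Ob[ Γ ]) → Hom (Γ ∙ A) Γ
    χ₁   : ∀ {Δ Γ} {σ : Hom Δ Γ} {B : Ob[ Δ ]} {A : Ob[ Γ ]}
         → Hom[ σ ] B A → Hom (Δ ∙ B) (Γ ∙ A)
    χ-square : ∀ {Δ Γ} {σ : Hom Δ Γ} {B A} (f : Hom[ σ ] B A)
             → pr A ∘ χ₁ f ≡ σ ∘ pr B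
    χ-id : ∀ {Γ} {A : Ob[ Γ ]} → χ₁ (id' {A = A}) ≡ id
    χ-∘  : ∀ {Θ Δ Γ} {σ : Hom Δ Γ} {τ : Hom Θ Δ} {A : Ob[ Γ ]} {B : Ob[ Δ ]} {C : Ob[ Θ ]}
             (f : Hom[ σ ] B A) (g : Hom[ τ ] C B) → χ₁ (f ∘' g) ≡ χ₁ f ∘ χ₁ g
    χ-full : ∀ {Δ Γ} {σ : Hom Δ Γ} {B : Ob[ Δ ]} {A : Ob[ Γ ]}
               (u : Hom (Δ ∙ B) (Γ ∙ A)) → pr A ∘ u ≡ σ ∘ pr B
           → Σ[ f ∈ Hom[ σ ] B A ] χ₁ f ≡ u
    χ-faithful : ∀ {Δ Γ} {σ : Hom Δ Γ} {B : Ob[ Δ ]} {A : Ob[ Γ ]}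
                   (f g : Hom[ σ ] B A) → χ₁ f ≡ χ₁ g → f ≡ g
    χ-cartesian : ∀ {Δ Γ} {σ : Hom Δ Γ} {B : Ob[ Δ ]} {A : Ob[ Γ ]}
                    (f : Hom[ σ ] B A) → IsCartesian f
                → IsPullback (pr A) σ (χ₁ f) (pr B)

-- All notions below (sections,
-- dependent sums, reindexing of maps, (LF)) only refer to these data.

record CompStructure (o ℓ t : Level) : Set (lsuc (o ⊔ ℓ ⊔ t)) where
  field
    C : Category o ℓ
  open Category C
  open CategoryNotions C
  infixl 5 _∙_
  field
    Ty   : Obj → Set t
    _∙_  : (Γ : Obj) → Ty Γ → Obj
    pr   : ∀ {Γ} (A : Ty Γ) → Hom (Γ ∙ A) Γ
    _[_] : ∀ {Δ Γ} → Ty Γ → Hom Δ Γ → Ty Δ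
    q    : ∀ {Δ Γ} (σ : Hom Δ Γ) (A : Ty Γ) → Hom (Δ ∙ A [ σ ]) (Γ ∙ A)
    q-pb : ∀ {Δ Γ} (σ : Hom Δ Γ) (A : Ty Γ) → IsPullback (pr A) σ (q σ A) (pr (A [ σ ]))

underlying : ∀ {o ℓ t h} → FullComprehensionCategory o ℓ t h → CompStructure o ℓ t
underlying 𝒞 = record
  { C = C ; Ty = Ob[_] ; _∙_ = _∙_ ; pr = pr ; _[_] = _[_]
  ; q = λ σ A → χ₁ (lift σ A)
  ; q-pb = λ σ A → χ-cartesian (lift σ A) (lift-cartesian σ A) }
  where
  open FullComprehensionCategory 𝒞
  open Displayed T
  open Cleaving cleaving

module StructureNotions {o ℓ t} (S : CompStructure o ℓ t) where
  open CompStructure S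
  open Category C
  open CategoryNotions C
  open ≡-Reasoning

  Sec : ∀ {Γ} → Ty Γ → Set ℓ
  Sec {Γ} A = Σ[ s ∈ Hom Γ (Γ ∙ A) ] (pr A ∘ s ≡ id)

  reindex-sec : ∀ {Δ Γ} {A : Ty Γ} (ρ : Hom Δ Γ) → Sec A → Sec (A [ ρ ])
  reindex-sec {A = A} ρ (s , s-sec) =
    witness U , proj₂ (has U)
    where
    eq : pr A ∘ (s ∘ ρ) ≡ ρ ∘ id
    eq = begin
      pr A ∘ (s ∘ ρ)  ≡⟨ sym assoc ⟩
      (pr A ∘ s) ∘ ρ  ≡⟨ cong (_∘ ρ) s-sec ⟩
      id ∘ ρ          ≡⟨ identityˡ ⟩
      ρ               ≡⟨ sym identityʳ ⟩
      ρ ∘ id          ∎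
    U = proj₂ (q-pb ρ A) (s ∘ ρ) id eq

  reindex-pair : ∀ {Δ Γ} (σ : Hom Δ Γ) {A : Ty Γ} {B : Ty (Γ ∙ A)} {S : Ty Γ}
                 (f : Hom (Γ ∙ A ∙ B) (Γ ∙ S)) → pr S ∘ f ≡ pr A ∘ pr B
               → Hom (Δ ∙ A [ σ ] ∙ B [ q σ A ]) (Δ ∙ S [ σ ])
  reindex-pair σ {A} {B} {S} f over =
    witness (proj₂ (q-pb σ S) (f ∘ q (q σ A) B) (pr (A [ σ ]) ∘ pr (B [ q σ A ])) eq)
    where
    eq : pr S ∘ (f ∘ q (q σ A) B) ≡ σ ∘ (pr (A [ σ ]) ∘ pr (B [ q σ A ]))
    eq = begin
      pr S ∘ (f ∘ q (q σ A) B)               ≡⟨ sym assoc ⟩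
      (pr S ∘ f) ∘ q (q σ A) B               ≡⟨ cong (_∘ q (q σ A) B) over ⟩
      (pr A ∘ pr B) ∘ q (q σ A) B            ≡⟨ assoc ⟩
      pr A ∘ (pr B ∘ q (q σ A) B)            ≡⟨ cong (pr A ∘_) (proj₁ (q-pb (q σ A) B)) ⟩
      pr A ∘ (q σ A ∘ pr (B [ q σ A ]))      ≡⟨ sym assoc ⟩
      (pr A ∘ q σ A) ∘ pr (B [ q σ A ])      ≡⟨ cong (_∘ pr (B [ q σ A ])) (proj₁ (q-pb σ A)) ⟩
      (σ ∘ pr (A [ σ ])) ∘ pr (B [ q σ A ])  ≡⟨ assoc ⟩
      σ ∘ (pr (A [ σ ]) ∘ pr (B [ q σ A ]))  ∎

  IsDepSum : ∀ {Γ} (A : Ty Γ) (B : Ty (Γ ∙ A)) (S : Ty Γ) (pair : Hom (Γ ∙ A ∙ B) (Γ ∙ S))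
           → Set (ℓ ⊔ t)
  IsDepSum {Γ} A B S pair =
    (pr S ∘ pair ≡ pr A ∘ pr B) ×
    (∀ (C : Ty (Γ ∙ S)) (d : Sec (C [ pair ]))
       → Σ[ s ∈ Sec C ] (proj₁ s ∘ pair ≡ q pair C ∘ proj₁ d))

  HasWeaklyStableSums : Set (o ⊔ ℓ ⊔ t)
  HasWeaklyStableSums =
    ∀ {Γ} (A : Ty Γ) (B : Ty (Γ ∙ A)) →
    Σ[ S ∈ Ty Γ ] Σ[ pair ∈ Hom (Γ ∙ A ∙ B) (Γ ∙ S) ]
    Σ[ over ∈ pr S ∘ pair ≡ pr A ∘ pr B ]
      (∀ {Δ} (σ : Hom Δ Γ) →
         IsDepSum (A [ σ ]) (B [ q σ A ]) (S [ σ ]) (reindex-pair σ pair over))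

  transport-sec : ∀ {Δ} {X Y : Ty Δ} (e : X ≡ Y) (T : Ty (Δ ∙ X))
                → Sec T → Sec (subst (λ Z → Ty (Δ ∙ Z)) e T)
  transport-sec refl T s = s

  record StrictlyStableSums : Set (o ⊔ ℓ ⊔ t) where
    field
      Sig   : ∀ {Γ} (A : Ty Γ) → Ty (Γ ∙ A) → Ty Γ
      pair  : ∀ {Γ} (A : Ty Γ) (B : Ty (Γ ∙ A)) → Hom (Γ ∙ A ∙ B) (Γ ∙ Sig A B)
      pair-over : ∀ {Γ} (A : Ty Γ) (B : Ty (Γ ∙ A))
                → pr (Sig A B) ∘ pair A B ≡ pr A ∘ pr B
      split : ∀ {Γ} (A : Ty Γ) (B : Ty (Γ ∙ A)) (C : Ty (Γ ∙ Sig A B))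
            → Sec (C [ pair A B ]) → Sec C
      split-β : ∀ {Γ} (A : Ty Γ) (B : Ty (Γ ∙ A)) (C : Ty (Γ ∙ Sig A B))
                  (d : Sec (C [ pair A B ]))
              → proj₁ (split A B C d) ∘ pair A B ≡ q (pair A B) C ∘ proj₁ d
      Sig-stable : ∀ {Δ Γ} (σ : Hom Δ Γ) (A : Ty Γ) (B : Ty (Γ ∙ A))
                 → Sig A B [ σ ] ≡ Sig (A [ σ ]) (B [ q σ A ])
      pair-stable : ∀ {Δ Γ} (σ : Hom Δ Γ) (A : Ty Γ) (B : Ty (Γ ∙ A))
                  → subst (λ X → Hom (Δ ∙ A [ σ ] ∙ B [ q σ A ]) (Δ ∙ X))
                          (Sig-stable σ A B)
                          (reindex-pair σ (pair A B) (pair-over A B))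
                    ≡ pair (A [ σ ]) (B [ q σ A ])
      -- split_{C,d}[σ] = split_{C[σ.Σ], d[σ.A.B]}
      -- (the type of d[σ.A.B] agrees with C[σ.Σ][pair'] up to the
      --  equality e, which holds on the nose in the split case)
      split-stable : ∀ {Δ Γ} (σ : Hom Δ Γ) (A : Ty Γ) (B : Ty (Γ ∙ A))
                       (C : Ty (Γ ∙ Sig A B)) (d : Sec (C [ pair A B ]))
                   → let C' = subst (λ X → Ty (Δ ∙ X)) (Sig-stable σ A B)
                                    (C [ q σ (Sig A B) ])
                     in (e : C [ pair A B ] [ q (q σ A) B ]
                             ≡ C' [ pair (A [ σ ]) (B [ q σ A ]) ])
                   → split (A [ σ ]) (B [ q σ A ]) C'
                           (subst Sec e (reindex-sec (q (q σ A) B) d))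
                     ≡ transport-sec (Sig-stable σ A B) (C [ q σ (Sig A B) ])
                         (reindex-sec (q σ (Sig A B)) (split A B C d))

  data IsDisplay : ∀ {Y X : Obj} → Hom Y X → Set (o ⊔ ℓ ⊔ t) where
    single : ∀ {Γ} (A : Ty Γ) → IsDisplay (pr A)
    comp   : ∀ {X Y Z} {f : Hom Y X} {g : Hom Z Y}
           → IsDisplay f → IsDisplay g → IsDisplay (f ∘ g)

  record LF : Set (o ⊔ ℓ ⊔ t) where
    field
      finite-products : FiniteProducts
      exp-display : ∀ {X Y Z} {f : Hom Y X} {g : Hom Z Y}
                  → IsDisplay f → IsDisplay g → DepExp f g
      exp-proj    : ∀ {X Y Z} {f : Hom Y X} {g : Hom Z Y}
                  → IsDisplay f → IsProductProjection g → DepExp f g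

module _ {o ℓ t h} (𝒞 : FullComprehensionCategory o ℓ t h) where
  open FullComprehensionCategory 𝒞
  open Category C
  open CategoryNotions C
  open Displayed T
  open Cleaving cleaving
  open ≡-Reasoning

  Ty! : Obj → Set (o ⊔ ℓ ⊔ t)
  Ty! Γ = Σ[ V ∈ Obj ] Σ[ E ∈ Ob[ V ] ] Hom Γ V

  ⟦_⟧! : ∀ {Γ} → Ty! Γ → Ob[ Γ ]
  ⟦ V , E , n ⟧! = E [ n ]

  reindex! : ∀ {Δ Γ} → Ty! Γ → Hom Δ Γ → Ty! Δ
  reindex! (V , E , n) σ = V , E , n ∘ σ

  lift! : ∀ {Δ Γ} (σ : Hom Δ Γ) (A : Ty! Γ) → Hom[ σ ] ⟦ reindex! A σ ⟧! ⟦ A ⟧!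
  lift! σ (V , E , n) = witness (lift-cartesian n E σ (lift (n ∘ σ) E))

  q! : ∀ {Δ Γ} (σ : Hom Δ Γ) (A : Ty! Γ) → Hom (Δ ∙ ⟦ reindex! A σ ⟧!) (Γ ∙ ⟦ A ⟧!)
  q! σ A = χ₁ (lift! σ A)

  q!-pb : ∀ {Δ Γ} (σ : Hom Δ Γ) (A : Ty! Γ)
        → IsPullback (pr ⟦ A ⟧!) σ (q! σ A) (pr ⟦ reindex! A σ ⟧!)
  q!-pb {Δ} {Γ} σ (V , E , n) = χ-square (lift! σ (V , E , n)) , univ
    where
    A = (V , E , n)
    Qn  = χ₁ (lift n E)
    Qnσ = χ₁ (lift (n ∘ σ) E)
    inner = χ-cartesian (lift n E) (lift-cartesian n E)
    outer = χ-cartesian (lift (n ∘ σ) E) (lift-cartesian (n ∘ σ) E)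
    tri : Qn ∘ q! σ A ≡ Qnσ
    tri = trans (sym (χ-∘ (lift n E) (lift! σ A)))
                (cong χ₁ (has (lift-cartesian n E σ (lift (n ∘ σ) E))))
    univ : ∀ {W} (hh : Hom W (Γ ∙ E [ n ])) (k : Hom W Δ)
         → pr (E [ n ]) ∘ hh ≡ σ ∘ k
         → Unique (Hom W (Δ ∙ E [ n ∘ σ ]))
                  (λ u → (q! σ A ∘ u ≡ hh) × (pr (E [ n ∘ σ ]) ∘ u ≡ k))
    univ {W} hh k sq = unique-intro (witness O) (e1 , proj₂ (has O)) uniq
      where
      osq : pr E ∘ (Qn ∘ hh) ≡ (n ∘ σ) ∘ k
      osq = begin
        pr E ∘ (Qn ∘ hh)          ≡⟨ sym assoc ⟩
        (pr E ∘ Qn) ∘ hh          ≡⟨ cong (_∘ hh) (proj₁ inner) ⟩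
        (n ∘ pr (E [ n ])) ∘ hh   ≡⟨ assoc ⟩
        n ∘ (pr (E [ n ]) ∘ hh)   ≡⟨ cong (n ∘_) sq ⟩
        n ∘ (σ ∘ k)               ≡⟨ sym assoc ⟩
        (n ∘ σ) ∘ k               ∎
      O = proj₂ outer (Qn ∘ hh) k osq
      u = witness O
      I = proj₂ inner (Qn ∘ hh) (pr (E [ n ]) ∘ hh)
            (trans (sym assoc) (trans (cong (_∘ hh) (proj₁ inner)) assoc))
      c1 : Qn ∘ (q! σ A ∘ u) ≡ Qn ∘ hh
      c1 = trans (sym assoc) (trans (cong (_∘ u) tri) (proj₁ (has O)))
      c2 : pr (E [ n ]) ∘ (q! σ A ∘ u) ≡ pr (E [ n ]) ∘ hh
      c2 = begin
        pr (E [ n ]) ∘ (q! σ A ∘ u)        ≡⟨ sym assoc ⟩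
        (pr (E [ n ]) ∘ q! σ A) ∘ u        ≡⟨ cong (_∘ u) (χ-square (lift! σ A)) ⟩
        (σ ∘ pr (E [ n ∘ σ ])) ∘ u         ≡⟨ assoc ⟩
        σ ∘ (pr (E [ n ∘ σ ]) ∘ u)         ≡⟨ cong (σ ∘_) (proj₂ (has O)) ⟩
        σ ∘ k                              ≡⟨ sym sq ⟩
        pr (E [ n ]) ∘ hh                  ∎
      e1 : q! σ A ∘ u ≡ hh
      e1 = trans (unique I (q! σ A ∘ u) (c1 , c2))
                 (sym (unique I hh (refl , refl)))
      uniq : ∀ y → (q! σ A ∘ y ≡ hh) × (pr (E [ n ∘ σ ]) ∘ y ≡ k) → y ≡ u
      uniq y (y1 , y2) = unique O y
        (trans (cong (_∘ y) (sym tri)) (trans assoc (cong (Qn ∘_) y1)) , y2)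

  _! : CompStructure o ℓ (o ⊔ ℓ ⊔ t)
  _! = record
    { C = C ; Ty = Ty! ; _∙_ = λ Γ A → Γ ∙ ⟦ A ⟧! ; pr = λ A → pr ⟦ A ⟧!
    ; _[_] = reindex! ; q = q! ; q-pb = q!-pb }

-- Weakly stable sums are stable only up to isomorphism, so the sums of 𝒞! are computed once and
-- for all in classifying contexts supplied by (LF). A 𝒞!-type A = (V_A, E_A, n_A) together with
-- B = (V_B, E_B, n_B) over Γ.A amounts to a single map n : Γ → Cl into the dependent exponential
-- Cl = Π[χ(E_A), π₁ : V_A.E_A × V_B → V_A.E_A], which carries a generic pair Aᵍ, Bᵍ. Choose a sum
-- Sᵍ of Aᵍ and Bᵍ and put Σ_A B := (Cl, Sᵍ, n). Reindexing A and B along σ precomposes their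
-- classifying map with σ, so by uniqueness of classifying maps Σ_A B[σ] = Σ_{A[σ]} B[σ] holds on
-- the nose, and pair is induced from the generic pair through n. For the eliminator, two more
-- exponentials W₁ → Cl and W₂ → W₁ classify a type C over Σ_A B and a section d of C[pair]:
-- split_{C,d} is the reindexing of one split chosen over W₂, hence strictly stable as well.

module Submission where

open import Defs
open import Data.Product using (Σ; _,_; proj₁; proj₂; _×_)
open import Data.Product.Properties using (Σ-≡,≡→≡)
open import Axiom.UniquenessOfIdentityProofs.WithK using (uip)
open import Relation.Binary.PropositionalEquality
  using (_≡_; refl; sym; trans; cong; subst; module ≡-Reasoning)

module CategoryLemmas {o ℓ} (𝒟 : Category o ℓ) where
  open Category 𝒟
  open CategoryNotions 𝒟
  open ≡-Reasoning

  pullˡ : ∀ {A B X D} {a : Hom X D} {b : Hom B X} {c : Hom B D} {x : Hom A B}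
        → a ∘ b ≡ c → a ∘ (b ∘ x) ≡ c ∘ x
  pullˡ {x = x} e = trans (sym assoc) (cong (_∘ x) e)

  pullʳ : ∀ {A B X D} {a : Hom B X} {b : Hom A B} {c : Hom A X} {x : Hom X D}
        → a ∘ b ≡ c → (x ∘ a) ∘ b ≡ x ∘ c
  pullʳ {x = x} e = trans assoc (cong (x ∘_) e)

  extendʳ : ∀ {A B X Y D} {a : Hom X D} {b : Hom B X} {c : Hom Y D} {d : Hom B Y} {x : Hom A B}
          → a ∘ b ≡ c ∘ d → a ∘ (b ∘ x) ≡ c ∘ (d ∘ x)
  extendʳ e = trans (pullˡ e) assoc

  module _ {P X Y Z} {f : Hom X Z} {g : Hom Y Z} {p₁ : Hom P X} {p₂ : Hom P Y}
           (pb : IsPullback f g p₁ p₂) where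

    opaque
      pb-universal : ∀ {W} (h : Hom W X) (k : Hom W Y) → f ∘ h ≡ g ∘ k → Hom W P
      pb-universal h k e = witness (proj₂ pb h k e)

      p₁∘pb-universal : ∀ {W} {h : Hom W X} {k : Hom W Y} (e : f ∘ h ≡ g ∘ k)
                      → p₁ ∘ pb-universal h k e ≡ h
      p₁∘pb-universal {h = h} {k} e = proj₁ (has (proj₂ pb h k e))

      p₂∘pb-universal : ∀ {W} {h : Hom W X} {k : Hom W Y} (e : f ∘ h ≡ g ∘ k)
                      → p₂ ∘ pb-universal h k e ≡ k
      p₂∘pb-universal {h = h} {k} e = proj₂ (has (proj₂ pb h k e))

    pb-jointly-monic : ∀ {W} (u v : Hom W P) → p₁ ∘ u ≡ p₁ ∘ v → p₂ ∘ u ≡ p₂ ∘ v → u ≡ v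
    pb-jointly-monic u v e₁ e₂ = trans (unique U u (e₁ , e₂)) (sym (unique U v (refl , refl)))
      where U = proj₂ pb (p₁ ∘ v) (p₂ ∘ v) (extendʳ (proj₁ pb))

    pb-universal-unique : ∀ {W} {h : Hom W X} {k : Hom W Y} (e : f ∘ h ≡ g ∘ k) (u : Hom W P)
                        → p₁ ∘ u ≡ h → p₂ ∘ u ≡ k → u ≡ pb-universal h k e
    pb-universal-unique e u e₁ e₂ = pb-jointly-monic u _
      (trans e₁ (sym (p₁∘pb-universal e))) (trans e₂ (sym (p₂∘pb-universal e)))

    pb-universal-∘ : ∀ {V W} {h : Hom W X} {k : Hom W Y} (e : f ∘ h ≡ g ∘ k) (r : Hom V W)
                       {h′ : Hom V X} {k′ : Hom V Y} (e′ : f ∘ h′ ≡ g ∘ k′)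
                   → h ∘ r ≡ h′ → k ∘ r ≡ k′ → pb-universal h k e ∘ r ≡ pb-universal h′ k′ e′
    pb-universal-∘ e r e′ hr kr = pb-universal-unique e′ _
      (trans (pullˡ (p₁∘pb-universal e)) hr) (trans (pullˡ (p₂∘pb-universal e)) kr)

    pb-swap : IsPullback g f p₂ p₁
    pb-swap = sym (proj₁ pb) , λ h k e →
      let U = proj₂ pb k h (sym e) in
      unique-intro (witness U) (proj₂ (has U) , proj₁ (has U))
                   (λ y y-has → unique U y (proj₂ y-has , proj₁ y-has))

  pb-paste : ∀ {P X Y Z R Y′} {f : Hom X Z} {g : Hom Y Z} {p₁ : Hom P X} {p₂ : Hom P Y}
               {g′ : Hom Y′ Y} {r₁ : Hom R P} {r₂ : Hom R Y′}
           → IsPullback f g p₁ p₂ → IsPullback p₂ g′ r₁ r₂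
           → IsPullback f (g ∘ g′) (p₁ ∘ r₁) r₂
  pb-paste {P = P} {X = X} {R = R} {Y′ = Y′} {f} {g} {p₁} {p₂} {g′} {r₁} {r₂} pb₁ pb₂ = square , factor
    where
    square : f ∘ (p₁ ∘ r₁) ≡ (g ∘ g′) ∘ r₂
    square = begin
      f ∘ (p₁ ∘ r₁)  ≡⟨ extendʳ (proj₁ pb₁) ⟩
      g ∘ (p₂ ∘ r₁)  ≡⟨ cong (g ∘_) (proj₁ pb₂) ⟩
      g ∘ (g′ ∘ r₂)  ≡⟨ sym assoc ⟩
      (g ∘ g′) ∘ r₂  ∎
    factor : ∀ {W} (h : Hom W X) (k : Hom W Y′) → f ∘ h ≡ (g ∘ g′) ∘ k
           → Unique (Hom W R) (λ u → ((p₁ ∘ r₁) ∘ u ≡ h) × (r₂ ∘ u ≡ k))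
    factor {W} h k e =
      unique-intro u (trans (pullʳ (p₁∘pb-universal pb₂ e₂)) (p₁∘pb-universal pb₁ e₁) ,
                      p₂∘pb-universal pb₂ e₂)
                   (λ y y-has → pb-universal-unique pb₂ e₂ y
                      (pb-universal-unique pb₁ e₁ (r₁ ∘ y) (trans (sym assoc) (proj₁ y-has))
                         (trans (extendʳ (proj₁ pb₂)) (cong (g′ ∘_) (proj₂ y-has))))
                      (proj₂ y-has))
      where
      e₁ : f ∘ h ≡ g ∘ (g′ ∘ k)
      e₁ = trans e assoc
      u₁ : Hom W P
      u₁ = pb-universal pb₁ h (g′ ∘ k) e₁
      e₂ : p₂ ∘ u₁ ≡ g′ ∘ k
      e₂ = p₂∘pb-universal pb₁ e₁
      u : Hom W R
      u = pb-universal pb₂ u₁ k e₂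

  pb-paste-vertical : ∀ {P X Y Z R X′} {f : Hom X Z} {g : Hom Y Z} {p₁ : Hom P X} {p₂ : Hom P Y}
                        {f′ : Hom X′ X} {q₁ : Hom R X′} {q₂ : Hom R P}
                    → IsPullback f g p₁ p₂ → IsPullback f′ p₁ q₁ q₂
                    → IsPullback (f ∘ f′) g q₁ (p₂ ∘ q₂)
  pb-paste-vertical pb₁ pb₂ = pb-swap (pb-paste (pb-swap pb₁) (pb-swap pb₂))

  pb-cancel : ∀ {P X Y Z R Y′} {f : Hom X Z} {g : Hom Y Z} {p₁ : Hom P X} {p₂ : Hom P Y}
                {g′ : Hom Y′ Y} {r₁ : Hom R P} {r₂ : Hom R Y′}
            → IsPullback f g p₁ p₂ → p₂ ∘ r₁ ≡ g′ ∘ r₂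
            → IsPullback f (g ∘ g′) (p₁ ∘ r₁) r₂ → IsPullback p₂ g′ r₁ r₂
  pb-cancel {P = P} {R = R} {Y′ = Y′} {f} {g} {p₁} {p₂} {g′} {r₁} {r₂} pb₁ square outer =
    square , factor
    where
    factor : ∀ {W} (h : Hom W P) (k : Hom W Y′) → p₂ ∘ h ≡ g′ ∘ k
           → Unique (Hom W R) (λ u → (r₁ ∘ u ≡ h) × (r₂ ∘ u ≡ k))
    factor {W} h k e =
      unique-intro u (r₁∘u , p₂∘pb-universal outer e′)
                   (λ y y-has → pb-universal-unique outer e′ y
                      (pullʳ (proj₁ y-has)) (proj₂ y-has))
      where
      e′ : f ∘ (p₁ ∘ h) ≡ (g ∘ g′) ∘ k
      e′ = trans (extendʳ (proj₁ pb₁)) (trans (cong (g ∘_) e) (sym assoc))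
      u : Hom W R
      u = pb-universal outer (p₁ ∘ h) k e′
      r₁∘u : r₁ ∘ u ≡ h
      r₁∘u = pb-jointly-monic pb₁ (r₁ ∘ u) h
        (trans (sym assoc) (p₁∘pb-universal outer e′))
        (trans (extendʳ square) (trans (cong (g′ ∘_) (p₂∘pb-universal outer e′)) (sym e)))

  pb-resp : ∀ {P X Y Z} {f : Hom X Z} {g g′ : Hom Y Z} {p₁ p₁′ : Hom P X} {p₂ : Hom P Y}
          → IsPullback f g p₁ p₂ → g ≡ g′ → p₁ ≡ p₁′ → IsPullback f g′ p₁′ p₂
  pb-resp pb refl refl = pb

  module Products (fp : FiniteProducts) where
    open FiniteProducts fp

    ⟨_,_⟩ : ∀ {W X Y} → Hom W X → Hom W Y → Hom W (prod X Y)
    ⟨ a , b ⟩ = witness (prod-is a b)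

    π₁∘⟨⟩ : ∀ {W X Y} {a : Hom W X} {b : Hom W Y} → π₁ ∘ ⟨ a , b ⟩ ≡ a
    π₁∘⟨⟩ {a = a} {b} = proj₁ (has (prod-is a b))

    π₂∘⟨⟩ : ∀ {W X Y} {a : Hom W X} {b : Hom W Y} → π₂ ∘ ⟨ a , b ⟩ ≡ b
    π₂∘⟨⟩ {a = a} {b} = proj₂ (has (prod-is a b))

    ⟨⟩-∘ : ∀ {V W X Y} {a : Hom W X} {b : Hom W Y} {r : Hom V W} {a′ : Hom V X} {b′ : Hom V Y}
         → a ∘ r ≡ a′ → b ∘ r ≡ b′ → ⟨ a , b ⟩ ∘ r ≡ ⟨ a′ , b′ ⟩
    ⟨⟩-∘ ar br = unique (prod-is _ _) _ (trans (pullˡ π₁∘⟨⟩) ar , trans (pullˡ π₂∘⟨⟩) br)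

    π₁-is-projection : ∀ {X Y} → IsProductProjection (π₁ {X} {Y})
    π₁-is-projection = _ , π₂ , prod-is

  module _ {X Y Z} {f : Hom Y X} {g : Hom Z Y} (D : DepExp f g) where
    open DepExp D

    Classifies : ∀ {W W′} → Hom W X → Hom W′ W → Hom W′ Y → Hom W′ Z → Hom W Π → Set ℓ
    Classifies w a b h k = (π ∘ k ≡ w) × (∀ m → e₁ ∘ m ≡ k ∘ a → e₂ ∘ m ≡ b → ev ∘ m ≡ h)

    Classifies-∘ : ∀ {W W′ V V′} {w : Hom W X} {a : Hom W′ W} {b : Hom W′ Y} {h : Hom W′ Z}
                     {k : Hom W Π} {w′ : Hom V X} {a′ : Hom V′ V} {b′ : Hom V′ Y} {h′ : Hom V′ Z}
                 → w ∘ a ≡ f ∘ b → Classifies w a b h k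
                 → (σ : Hom V W) (r : Hom V′ W′)
                 → w ∘ σ ≡ w′ → a ∘ r ≡ σ ∘ a′ → b ∘ r ≡ b′ → h ∘ r ≡ h′
                 → Classifies w′ a′ b′ h′ (k ∘ σ)
    Classifies-∘ {W′ = W′} {a = a} {b} {h} {k} {a′ = a′} {b′} {h′} square (πk , evk) σ r wσ ar br hr =
      trans (pullˡ πk) wσ , evkσ
      where
      e : π ∘ (k ∘ a) ≡ f ∘ b
      e = trans (pullˡ πk) square
      m₀ : Hom W′ P'
      m₀ = pb-universal e-pb (k ∘ a) b e
      evkσ : ∀ m → e₁ ∘ m ≡ (k ∘ σ) ∘ a′ → e₂ ∘ m ≡ b′ → ev ∘ m ≡ h′
      evkσ m e₁m e₂m = begin
        ev ∘ m          ≡⟨ cong (ev ∘_) (pb-jointly-monic e-pb m (m₀ ∘ r) e₁-eq e₂-eq) ⟩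
        ev ∘ (m₀ ∘ r)   ≡⟨ pullˡ (evk m₀ (p₁∘pb-universal e-pb e) (p₂∘pb-universal e-pb e)) ⟩
        h ∘ r           ≡⟨ hr ⟩
        h′              ∎
        where
        e₁-eq : e₁ ∘ m ≡ e₁ ∘ (m₀ ∘ r)
        e₁-eq = begin
          e₁ ∘ m          ≡⟨ e₁m ⟩
          (k ∘ σ) ∘ a′    ≡⟨ pullʳ (sym ar) ⟩
          k ∘ (a ∘ r)     ≡⟨ sym assoc ⟩
          (k ∘ a) ∘ r     ≡⟨ sym (pullˡ (p₁∘pb-universal e-pb e)) ⟩
          e₁ ∘ (m₀ ∘ r)   ∎
        e₂-eq : e₂ ∘ m ≡ e₂ ∘ (m₀ ∘ r)
        e₂-eq = trans e₂m (sym (trans (pullˡ (p₂∘pb-universal e-pb e)) br))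

module ReindexingLemmas {o ℓ t} (𝒮 : CompStructure o ℓ t) where
  open CompStructure 𝒮
  open Category C
  open CategoryNotions C
  open CategoryLemmas C
  open StructureNotions 𝒮

  q∘reindex-pair : ∀ {Δ Γ} (σ : Hom Δ Γ) {A : Ty Γ} {B : Ty (Γ ∙ A)} {S : Ty Γ}
                     (f : Hom (Γ ∙ A ∙ B) (Γ ∙ S)) (over : pr S ∘ f ≡ pr A ∘ pr B)
                 → q σ S ∘ reindex-pair σ f over ≡ f ∘ q (q σ A) B
  q∘reindex-pair σ {A} {B} {S} f _ =
    proj₁ (has (proj₂ (q-pb σ S) (f ∘ q (q σ A) B) (pr (A [ σ ]) ∘ pr (B [ q σ A ])) _))

  pr∘reindex-pair : ∀ {Δ Γ} (σ : Hom Δ Γ) {A : Ty Γ} {B : Ty (Γ ∙ A)} {S : Ty Γ}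
                      (f : Hom (Γ ∙ A ∙ B) (Γ ∙ S)) (over : pr S ∘ f ≡ pr A ∘ pr B)
                  → pr (S [ σ ]) ∘ reindex-pair σ f over ≡ pr (A [ σ ]) ∘ pr (B [ q σ A ])
  pr∘reindex-pair σ {A} {B} {S} f _ =
    proj₂ (has (proj₂ (q-pb σ S) (f ∘ q (q σ A) B) (pr (A [ σ ]) ∘ pr (B [ q σ A ])) _))

  q∘reindex-sec : ∀ {Δ Γ} (ρ : Hom Δ Γ) {A : Ty Γ} (s : Sec A)
                → q ρ A ∘ proj₁ (reindex-sec ρ s) ≡ proj₁ s ∘ ρ
  q∘reindex-sec ρ {A} (s , _) = proj₁ (has (proj₂ (q-pb ρ A) (s ∘ ρ) id _))

  Sec-≡ : ∀ {Γ} {A : Ty Γ} {s u : Sec A} → proj₁ s ≡ proj₁ u → s ≡ u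
  Sec-≡ e = Σ-≡,≡→≡ (e , uip _ _)

  q₂ : ∀ {Y X} (m : Hom Y X) (A : Ty X) (B : Ty (X ∙ A)) → Hom (Y ∙ A [ m ] ∙ B [ q m A ]) (X ∙ A ∙ B)
  q₂ m A B = q (q m A) B

  opaque
    q₂-pb : ∀ {Y X} (m : Hom Y X) (A : Ty X) (B : Ty (X ∙ A))
          → IsPullback (pr A ∘ pr B) m (q₂ m A B) (pr (A [ m ]) ∘ pr (B [ q m A ]))
    q₂-pb m A B = pb-paste-vertical (q-pb m A) (q-pb (q m A) B)

module SplitSums {o ℓ t h} (𝒞 : FullComprehensionCategory o ℓ t h)
  (lf : StructureNotions.LF (underlying 𝒞))
  (wss : StructureNotions.HasWeaklyStableSums (underlying 𝒞)) where

  open CompStructure (underlying 𝒞)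
  open Category C
  open CategoryNotions C
  open CategoryLemmas C
  open ReindexingLemmas (underlying 𝒞)
  module U = StructureNotions (underlying 𝒞)
  module K = StructureNotions (𝒞 !)
  module K! = ReindexingLemmas (𝒞 !)
  open StructureNotions.LF lf
  open FiniteProducts finite-products using (π₁; π₂)
  open Products finite-products
  open ≡-Reasoning

  ⟦_⟧ : ∀ {Γ} → Ty! 𝒞 Γ → Ty Γ
  ⟦_⟧ = ⟦_⟧! 𝒞

  q∘q! : ∀ {Δ Γ V} (σ : Hom Δ Γ) (E : Ty V) (n : Hom Γ V)
       → q n E ∘ q! 𝒞 σ (V , E , n) ≡ q (n ∘ σ) E
  q∘q! σ E n = trans (sym (χ-∘ (lift n E) (lift! 𝒞 σ (_ , E , n))))
                     (cong χ₁ (has (lift-cartesian n E σ (lift (n ∘ σ) E))))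
    where
    open FullComprehensionCategory 𝒞 using (χ₁; χ-∘; cleaving)
    open Displayed.Cleaving cleaving using (lift; lift-cartesian)

  pr∘q! : ∀ {Δ Γ V} (σ : Hom Δ Γ) (E : Ty V) (n : Hom Γ V)
        → pr (E [ n ]) ∘ q! 𝒞 σ (V , E , n) ≡ σ ∘ pr (E [ n ∘ σ ])
  pr∘q! σ E n = proj₁ (q!-pb 𝒞 σ (_ , E , n))

  module _ {V Y Y′ : Obj} (E : Ty V) {m : Hom Y V} {m′ : Hom Y′ V} (x : Hom Y′ Y) (p : m ∘ x ≡ m′) where
    opaque
      private
        square : pr E ∘ q m′ E ≡ m ∘ (x ∘ pr (E [ m′ ]))
        square = trans (proj₁ (q-pb m′ E)) (trans (cong (_∘ pr (E [ m′ ])) (sym p)) assoc)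

      reindex-cmp : Hom (Y′ ∙ E [ m′ ]) (Y ∙ E [ m ])
      reindex-cmp = pb-universal (q-pb m E) (q m′ E) (x ∘ pr (E [ m′ ])) square

      q∘reindex-cmp : q m E ∘ reindex-cmp ≡ q m′ E
      q∘reindex-cmp = p₁∘pb-universal (q-pb m E) square

      pr∘reindex-cmp : pr (E [ m ]) ∘ reindex-cmp ≡ x ∘ pr (E [ m′ ])
      pr∘reindex-cmp = p₂∘pb-universal (q-pb m E) square

      reindex-cmp-pb : IsPullback (pr (E [ m ])) x reindex-cmp (pr (E [ m′ ]))
      reindex-cmp-pb = pb-cancel (q-pb m E) pr∘reindex-cmp
                         (pb-resp (q-pb m′ E) (sym p) (sym q∘reindex-cmp))

  reindex-cmp-∘ : ∀ {V Y Y′ Δ} (E : Ty V) {m : Hom Y V} {m′ : Hom Y′ V} {x : Hom Y′ Y}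
                    (p : m ∘ x ≡ m′) (σ : Hom Δ Y′) {x′ : Hom Δ Y} (p′ : m ∘ x′ ≡ m′ ∘ σ)
                → x ∘ σ ≡ x′ → reindex-cmp E x p ∘ q! 𝒞 σ (V , E , m′) ≡ reindex-cmp E x′ p′
  reindex-cmp-∘ {V} E {m} {m′} {x} p σ {x′} p′ xσ = pb-jointly-monic (q-pb m E) _ _
    (begin
      q m E ∘ (reindex-cmp E x p ∘ q! 𝒞 σ (V , E , m′))  ≡⟨ pullˡ (q∘reindex-cmp E x p) ⟩
      q m′ E ∘ q! 𝒞 σ (V , E , m′)                       ≡⟨ q∘q! σ E m′ ⟩
      q (m′ ∘ σ) E                                       ≡⟨ sym (q∘reindex-cmp E x′ p′) ⟩
      q m E ∘ reindex-cmp E x′ p′                        ∎)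
    (begin
      pr (E [ m ]) ∘ (reindex-cmp E x p ∘ q! 𝒞 σ (V , E , m′))  ≡⟨ pullˡ (pr∘reindex-cmp E x p) ⟩
      (x ∘ pr (E [ m′ ])) ∘ q! 𝒞 σ (V , E , m′)                ≡⟨ pullʳ (pr∘q! σ E m′) ⟩
      x ∘ (σ ∘ pr (E [ m′ ∘ σ ]))                              ≡⟨ sym assoc ⟩
      (x ∘ σ) ∘ pr (E [ m′ ∘ σ ])                              ≡⟨ cong (_∘ pr (E [ m′ ∘ σ ])) xσ ⟩
      x′ ∘ pr (E [ m′ ∘ σ ])                                   ≡⟨ sym (pr∘reindex-cmp E x′ p′) ⟩
      pr (E [ m ]) ∘ reindex-cmp E x′ p′                       ∎)

  reindex-cmp-comp : ∀ {V Y Y′ Y″} (E : Ty V) {m : Hom Y V} {m′ : Hom Y′ V} {m″ : Hom Y″ V}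
                       {x : Hom Y′ Y} {y : Hom Y″ Y′} {z : Hom Y″ Y}
                       (p : m ∘ x ≡ m′) (p′ : m′ ∘ y ≡ m″) (p″ : m ∘ z ≡ m″)
                   → x ∘ y ≡ z → reindex-cmp E x p ∘ reindex-cmp E y p′ ≡ reindex-cmp E z p″
  reindex-cmp-comp E {m} {m′} {m″} {x} {y} {z} p p′ p″ xy = pb-jointly-monic (q-pb m E) _ _
    (trans (pullˡ (q∘reindex-cmp E x p))
           (trans (q∘reindex-cmp E y p′) (sym (q∘reindex-cmp E z p″))))
    (begin
      pr (E [ m ]) ∘ (reindex-cmp E x p ∘ reindex-cmp E y p′)  ≡⟨ pullˡ (pr∘reindex-cmp E x p) ⟩
      (x ∘ pr (E [ m′ ])) ∘ reindex-cmp E y p′                ≡⟨ pullʳ (pr∘reindex-cmp E y p′) ⟩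
      x ∘ (y ∘ pr (E [ m″ ]))                                 ≡⟨ sym assoc ⟩
      (x ∘ y) ∘ pr (E [ m″ ])                                 ≡⟨ cong (_∘ pr (E [ m″ ])) xy ⟩
      z ∘ pr (E [ m″ ])                                       ≡⟨ sym (pr∘reindex-cmp E z p″) ⟩
      pr (E [ m ]) ∘ reindex-cmp E z p″                       ∎)

  q∘subst-Sec : ∀ {Y V} {E : Ty V} {m₀ m₁ : Hom Y V}
                  (e : _≡_ {A = Ty! 𝒞 Y} (V , E , m₀) (V , E , m₁)) (s : K.Sec (V , E , m₀))
              → q m₁ E ∘ proj₁ (subst K.Sec e s) ≡ q m₀ E ∘ proj₁ s
  q∘subst-Sec refl s = refl

  -- Cl represents pairs (m : Γ → V, m′ : Γ.E[m] → V′), i.e. it is Σ (v : V) (E v → V′);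
  -- eval is the generic m′.
  module MapClassifier {V : Obj} (E : Ty V) (V′ : Obj) where
    private
      opaque
        D : DepExp (pr E) (π₁ {V ∙ E} {V′})
        D = exp-proj (U.single E) π₁-is-projection
      module D = DepExp D

    Cl : Obj
    Cl = D.Π

    base : Hom Cl V
    base = D.π

    E* : Ty Cl
    E* = E [ base ]

    Represents : ∀ {Γ} (m : Hom Γ V) → Hom (Γ ∙ E [ m ]) V′ → Hom Γ Cl → Set ℓ
    Represents m m′ = Classifies D m (pr (E [ m ])) (q m E) ⟨ q m E , m′ ⟩

    representation : ∀ {Γ} (m : Hom Γ V) (m′ : Hom (Γ ∙ E [ m ]) V′)
                   → Unique (Hom Γ Cl) (Represents m m′)
    representation m m′ =
      D.universal m (pr (E [ m ])) (q m E) (pb-swap (q-pb m E)) ⟨ q m E , m′ ⟩ π₁∘⟨⟩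

    classify : ∀ {Γ} (m : Hom Γ V) → Hom (Γ ∙ E [ m ]) V′ → Hom Γ Cl
    classify m m′ = witness (representation m m′)

    classify-represents : ∀ {Γ} (m : Hom Γ V) (m′ : Hom (Γ ∙ E [ m ]) V′)
                        → Represents m m′ (classify m m′)
    classify-represents m m′ = has (representation m m′)

    classify-∘ : ∀ {Δ Γ} (m : Hom Γ V) (m′ : Hom (Γ ∙ E [ m ]) V′) (σ : Hom Δ Γ)
               → classify m m′ ∘ σ ≡ classify (m ∘ σ) (m′ ∘ q! 𝒞 σ (V , E , m))
    classify-∘ m m′ σ = unique (representation _ _) _
      (Classifies-∘ D (sym (proj₁ (q-pb m E))) (classify-represents m m′) σ (q! 𝒞 σ (V , E , m))
        refl (pr∘q! σ E m) (q∘q! σ E m) (⟨⟩-∘ (q∘q! σ E m) refl))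

    opaque
      private
        generic-square : base ∘ pr E* ≡ pr E ∘ q base E
        generic-square = sym (proj₁ (q-pb base E))

        generic : Hom (Cl ∙ E*) D.P'
        generic = pb-universal D.e-pb (pr E*) (q base E) generic-square

      eval : Hom (Cl ∙ E*) V′
      eval = π₂ ∘ (D.ev ∘ generic)

      eval∘reindex-cmp : ∀ {Γ} {m : Hom Γ V} {m′ : Hom (Γ ∙ E [ m ]) V′} {k : Hom Γ Cl}
                         (rep : Represents m m′ k) → eval ∘ reindex-cmp E k (proj₁ rep) ≡ m′
      eval∘reindex-cmp {Γ} {m} {m′} {k} rep = begin
        (π₂ ∘ (D.ev ∘ generic)) ∘ cmp  ≡⟨ pullʳ assoc ⟩
        π₂ ∘ (D.ev ∘ (generic ∘ cmp))  ≡⟨ cong (π₂ ∘_) (proj₂ rep (generic ∘ cmp) e₁-eq e₂-eq) ⟩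
        π₂ ∘ ⟨ q m E , m′ ⟩            ≡⟨ π₂∘⟨⟩ ⟩
        m′                             ∎
        where
        cmp : Hom (Γ ∙ E [ m ]) (Cl ∙ E*)
        cmp = reindex-cmp E k (proj₁ rep)
        e₁-eq : D.e₁ ∘ (generic ∘ cmp) ≡ k ∘ pr (E [ m ])
        e₁-eq = trans (pullˡ (p₁∘pb-universal D.e-pb generic-square)) (pr∘reindex-cmp E k (proj₁ rep))
        e₂-eq : D.e₂ ∘ (generic ∘ cmp) ≡ q m E
        e₂-eq = trans (pullˡ (p₂∘pb-universal D.e-pb generic-square)) (q∘reindex-cmp E k (proj₁ rep))

  module GenericPair {VA : Obj} (EA : Ty VA) {VB : Obj} (EB : Ty VB) where
    open MapClassifier EA VB public

    Aᵍ : Ty Cl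
    Aᵍ = E*

    Bᵍ : Ty (Cl ∙ Aᵍ)
    Bᵍ = EB [ eval ]

    Sᵍ : Ty Cl
    Sᵍ = proj₁ (wss Aᵍ Bᵍ)

    Sᵍ! : ∀ {Γ} → Hom Γ Cl → Ty! 𝒞 Γ
    Sᵍ! n = Cl , Sᵍ , n

    pairᵍ : Hom (Cl ∙ Aᵍ ∙ Bᵍ) (Cl ∙ Sᵍ)
    pairᵍ = proj₁ (proj₂ (wss Aᵍ Bᵍ))

    pairᵍ-over : pr Sᵍ ∘ pairᵍ ≡ pr Aᵍ ∘ pr Bᵍ
    pairᵍ-over = proj₁ (proj₂ (proj₂ (wss Aᵍ Bᵍ)))

    opaque
      pairᵍ[_] : ∀ {Y} (m : Hom Y Cl) → Hom (Y ∙ Aᵍ [ m ] ∙ Bᵍ [ q m Aᵍ ]) (Y ∙ Sᵍ [ m ])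
      pairᵍ[ m ] = U.reindex-pair m pairᵍ pairᵍ-over

      pairᵍ[]-is-sum : ∀ {Y} (m : Hom Y Cl)
                     → U.IsDepSum (Aᵍ [ m ]) (Bᵍ [ q m Aᵍ ]) (Sᵍ [ m ]) pairᵍ[ m ]
      pairᵍ[]-is-sum = proj₂ (proj₂ (proj₂ (wss Aᵍ Bᵍ)))

      q∘pairᵍ[] : ∀ {Y} (m : Hom Y Cl) → q m Sᵍ ∘ pairᵍ[ m ] ≡ pairᵍ ∘ q₂ m Aᵍ Bᵍ
      q∘pairᵍ[] m = q∘reindex-pair m pairᵍ pairᵍ-over

      pr∘pairᵍ[] : ∀ {Y} (m : Hom Y Cl)
                 → pr (Sᵍ [ m ]) ∘ pairᵍ[ m ] ≡ pr (Aᵍ [ m ]) ∘ pr (Bᵍ [ q m Aᵍ ])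
      pr∘pairᵍ[] m = pr∘reindex-pair m pairᵍ pairᵍ-over

    pairᵍ[]∘≡ : ∀ {Y W} (m : Hom Y Cl) {u : Hom W (Y ∙ Aᵍ [ m ] ∙ Bᵍ [ q m Aᵍ ])}
                  {v : Hom W (Y ∙ Sᵍ [ m ])}
              → pairᵍ ∘ (q₂ m Aᵍ Bᵍ ∘ u) ≡ q m Sᵍ ∘ v
              → (pr (Aᵍ [ m ]) ∘ pr (Bᵍ [ q m Aᵍ ])) ∘ u ≡ pr (Sᵍ [ m ]) ∘ v
              → pairᵍ[ m ] ∘ u ≡ v
    pairᵍ[]∘≡ m q-eq pr-eq = pb-jointly-monic (q-pb m Sᵍ) _ _
      (trans (pullˡ (q∘pairᵍ[] m)) (trans assoc q-eq))
      (trans (pullˡ (pr∘pairᵍ[] m)) pr-eq)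

    module Pair {Γ} {nA : Hom Γ VA} {nB : Hom (Γ ∙ EA [ nA ]) VB} {n : Hom Γ Cl}
                (rep : Represents nA nB n) where

      prAB : Hom (Γ ∙ EA [ nA ] ∙ EB [ nB ]) Γ
      prAB = pr (EA [ nA ]) ∘ pr (EB [ nB ])

      cA : Hom (Γ ∙ EA [ nA ]) (Cl ∙ Aᵍ)
      cA = reindex-cmp EA n (proj₁ rep)

      c : Hom (Γ ∙ EA [ nA ] ∙ EB [ nB ]) (Cl ∙ Aᵍ ∙ Bᵍ)
      c = reindex-cmp EB cA (eval∘reindex-cmp rep)

      opaque
        c-pb : IsPullback (pr Aᵍ ∘ pr Bᵍ) n c prAB
        c-pb = pb-paste-vertical (reindex-cmp-pb EA n (proj₁ rep))
                                 (reindex-cmp-pb EB cA (eval∘reindex-cmp rep))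

        private
          pair-square : pr Sᵍ ∘ (pairᵍ ∘ c) ≡ n ∘ prAB
          pair-square = trans (pullˡ pairᵍ-over) (proj₁ c-pb)

        pair : Hom (Γ ∙ EA [ nA ] ∙ EB [ nB ]) (Γ ∙ Sᵍ [ n ])
        pair = pb-universal (q-pb n Sᵍ) (pairᵍ ∘ c) prAB pair-square

        q∘pair : q n Sᵍ ∘ pair ≡ pairᵍ ∘ c
        q∘pair = p₁∘pb-universal (q-pb n Sᵍ) pair-square

        pr∘pair : pr (Sᵍ [ n ]) ∘ pair ≡ prAB
        pr∘pair = p₂∘pb-universal (q-pb n Sᵍ) pair-square

        pair-unique : ∀ {u : Hom (Γ ∙ EA [ nA ] ∙ EB [ nB ]) (Γ ∙ Sᵍ [ n ])}
                    → q n Sᵍ ∘ u ≡ pairᵍ ∘ c → pr (Sᵍ [ n ]) ∘ u ≡ prAB → u ≡ pair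
        pair-unique = pb-universal-unique (q-pb n Sᵍ) pair-square _

      module _ {Y} {m : Hom Y Cl} (x : Hom Γ Y) (p : m ∘ x ≡ n) where
        opaque
          c-via-square : (pr Aᵍ ∘ pr Bᵍ) ∘ c ≡ m ∘ (x ∘ prAB)
          c-via-square = trans (proj₁ c-pb) (trans (cong (_∘ prAB) (sym p)) assoc)

        c-via : Hom (Γ ∙ EA [ nA ] ∙ EB [ nB ]) (Y ∙ Aᵍ [ m ] ∙ Bᵍ [ q m Aᵍ ])
        c-via = pb-universal (q₂-pb m Aᵍ Bᵍ) c (x ∘ prAB) c-via-square

        q₂∘c-via : q₂ m Aᵍ Bᵍ ∘ c-via ≡ c
        q₂∘c-via = p₁∘pb-universal (q₂-pb m Aᵍ Bᵍ) c-via-square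

        pr₂∘c-via : (pr (Aᵍ [ m ]) ∘ pr (Bᵍ [ q m Aᵍ ])) ∘ c-via ≡ x ∘ prAB
        pr₂∘c-via = p₂∘pb-universal (q₂-pb m Aᵍ Bᵍ) c-via-square

        opaque
          c-via-pb : IsPullback x (pr (Aᵍ [ m ]) ∘ pr (Bᵍ [ q m Aᵍ ])) prAB c-via
          c-via-pb = pb-swap (pb-cancel (q₂-pb m Aᵍ Bᵍ) pr₂∘c-via
                                        (pb-resp c-pb (sym p) (sym q₂∘c-via)))

        pairᵍ[]∘c-via : pairᵍ[ m ] ∘ c-via ≡ reindex-cmp Sᵍ x p ∘ pair
        pairᵍ[]∘c-via = pairᵍ[]∘≡ m
          (begin
            pairᵍ ∘ (q₂ m Aᵍ Bᵍ ∘ c-via)          ≡⟨ cong (pairᵍ ∘_) q₂∘c-via ⟩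
            pairᵍ ∘ c                              ≡⟨ sym q∘pair ⟩
            q n Sᵍ ∘ pair                          ≡⟨ sym (pullˡ (q∘reindex-cmp Sᵍ x p)) ⟩
            q m Sᵍ ∘ (reindex-cmp Sᵍ x p ∘ pair)   ∎)
          (begin
            (pr (Aᵍ [ m ]) ∘ pr (Bᵍ [ q m Aᵍ ])) ∘ c-via  ≡⟨ pr₂∘c-via ⟩
            x ∘ prAB                                      ≡⟨ cong (x ∘_) (sym pr∘pair) ⟩
            x ∘ (pr (Sᵍ [ n ]) ∘ pair)                    ≡⟨ sym (extendʳ (pr∘reindex-cmp Sᵍ x p)) ⟩
            pr (Sᵍ [ m ]) ∘ (reindex-cmp Sᵍ x p ∘ pair)   ∎)

    module Pair-∘ {Δ Γ} (σ : Hom Δ Γ) {nA : Hom Γ VA} {nB : Hom (Γ ∙ EA [ nA ]) VB} {n : Hom Γ Cl}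
                  (rep : Represents nA nB n)
                  (rep′ : Represents (nA ∘ σ) (nB ∘ q! 𝒞 σ (VA , EA , nA)) (n ∘ σ)) where
      private
        module P = Pair rep
        module P′ = Pair rep′

      qA : Hom (Δ ∙ EA [ nA ∘ σ ]) (Γ ∙ EA [ nA ])
      qA = q! 𝒞 σ (VA , EA , nA)

      qAB : Hom (Δ ∙ EA [ nA ∘ σ ] ∙ EB [ nB ∘ qA ]) (Γ ∙ EA [ nA ] ∙ EB [ nB ])
      qAB = q! 𝒞 qA (VB , EB , nB)

      prAB∘qAB : P.prAB ∘ qAB ≡ σ ∘ P′.prAB
      prAB∘qAB = proj₁ (K!.q₂-pb σ (VA , EA , nA) (VB , EB , nB))

      c-∘ : P.c ∘ qAB ≡ P′.c
      c-∘ = reindex-cmp-∘ EB (eval∘reindex-cmp rep) qA (eval∘reindex-cmp rep′)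
              (reindex-cmp-∘ EA (proj₁ rep) σ (proj₁ rep′) refl)

      c-via-∘ : ∀ {Y} {m : Hom Y Cl} {x : Hom Γ Y} (p : m ∘ x ≡ n) {x′ : Hom Δ Y}
                  (p′ : m ∘ x′ ≡ n ∘ σ) → x ∘ σ ≡ x′ → P.c-via x p ∘ qAB ≡ P′.c-via x′ p′
      c-via-∘ {m = m} {x} p {x′} p′ xσ =
        pb-universal-∘ (q₂-pb m Aᵍ Bᵍ) (P.c-via-square x p) qAB (P′.c-via-square x′ p′) c-∘
          (begin
            (x ∘ P.prAB) ∘ qAB  ≡⟨ pullʳ prAB∘qAB ⟩
            x ∘ (σ ∘ P′.prAB)   ≡⟨ sym assoc ⟩
            (x ∘ σ) ∘ P′.prAB   ≡⟨ cong (_∘ P′.prAB) xσ ⟩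
            x′ ∘ P′.prAB        ∎)

      pair-∘ : K.reindex-pair σ {VA , EA , nA} {VB , EB , nB} {Sᵍ! n} P.pair P.pr∘pair ≡ P′.pair
      pair-∘ = P′.pair-unique
        (begin
          q (n ∘ σ) Sᵍ ∘ rp                     ≡⟨ cong (_∘ rp) (sym (q∘q! σ Sᵍ n)) ⟩
          (q n Sᵍ ∘ q! 𝒞 σ (Sᵍ! n)) ∘ rp        ≡⟨ pullʳ (K!.q∘reindex-pair σ P.pair P.pr∘pair) ⟩
          q n Sᵍ ∘ (P.pair ∘ qAB)               ≡⟨ pullˡ P.q∘pair ⟩
          (pairᵍ ∘ P.c) ∘ qAB                   ≡⟨ pullʳ c-∘ ⟩
          pairᵍ ∘ P′.c                          ∎)
        (K!.pr∘reindex-pair σ P.pair P.pr∘pair)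
        where
        rp = K.reindex-pair σ {VA , EA , nA} {VB , EB , nB} {Sᵍ! n} P.pair P.pr∘pair

    pair-stable : ∀ {Δ Γ} (σ : Hom Δ Γ) {nA : Hom Γ VA} {nB : Hom (Γ ∙ EA [ nA ]) VB} {n : Hom Γ Cl}
                    (rep : Represents nA nB n)
                    {n′ : Hom Δ Cl} (rep′ : Represents (nA ∘ σ) (nB ∘ q! 𝒞 σ (VA , EA , nA)) n′)
                    (p : n ∘ σ ≡ n′)
                → subst (λ X → Hom (Δ ∙ EA [ nA ∘ σ ] ∙ EB [ nB ∘ q! 𝒞 σ (VA , EA , nA) ]) (Δ ∙ ⟦ X ⟧))
                        (cong Sᵍ! p)
                        (K.reindex-pair σ {VA , EA , nA} {VB , EB , nB} {Sᵍ! n}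
                           (Pair.pair rep) (Pair.pr∘pair rep))
                  ≡ Pair.pair rep′
    pair-stable σ rep rep′ refl = Pair-∘.pair-∘ σ rep rep′

  module GenericSplit {VA : Obj} (EA : Ty VA) {VB : Obj} (EB : Ty VB) {VC : Obj} (EC : Ty VC) where
    open GenericPair EA EB

    -- W₁ represents the data n_C of a type C over Γ.Σ_A B; over it, W₂ represents sections
    -- of C₁[pair₁]. The generic such section is dᵍ, and every split is a reindexing of sᵍ.
    module W₁ = MapClassifier Sᵍ VC

    ρ₁ : Hom W₁.Cl Cl
    ρ₁ = W₁.base

    A₁ : Ty W₁.Cl
    A₁ = Aᵍ [ ρ₁ ]

    B₁ : Ty (W₁.Cl ∙ A₁)
    B₁ = Bᵍ [ q ρ₁ Aᵍ ]

    C₁ : Ty (W₁.Cl ∙ W₁.E*)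
    C₁ = EC [ W₁.eval ]

    pair₁ : Hom (W₁.Cl ∙ A₁ ∙ B₁) (W₁.Cl ∙ W₁.E*)
    pair₁ = pairᵍ[ ρ₁ ]

    qC₁ : Hom (W₁.Cl ∙ A₁ ∙ B₁ ∙ C₁ [ pair₁ ]) (VC ∙ EC)
    qC₁ = q W₁.eval EC ∘ q pair₁ C₁

    opaque
      qC₁-pb : IsPullback (pr EC) (W₁.eval ∘ pair₁) qC₁ (pr (C₁ [ pair₁ ]))
      qC₁-pb = pb-paste (q-pb W₁.eval EC) (q-pb pair₁ C₁)

      D₃ : DepExp (pr A₁ ∘ pr B₁) (pr (C₁ [ pair₁ ]))
      D₃ = exp-display (U.comp (U.single A₁) (U.single B₁)) (U.single (C₁ [ pair₁ ]))

    module D₃ = DepExp D₃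

    W₂ : Obj
    W₂ = D₃.Π

    ρ₂ : Hom W₂ W₁.Cl
    ρ₂ = D₃.π

    -- The generic pair is reindexed along τ in one step: weak stability makes pairᵍ[ m ] a sum
    -- for every m, but says nothing about reindexings of pairᵍ[ ρ₁ ] along ρ₂.
    τ : Hom W₂ Cl
    τ = ρ₁ ∘ ρ₂

    A₂ : Ty W₂
    A₂ = Aᵍ [ τ ]

    B₂ : Ty (W₂ ∙ A₂)
    B₂ = Bᵍ [ q τ Aᵍ ]

    S₂ : Ty W₂
    S₂ = Sᵍ [ τ ]

    pair₂ : Hom (W₂ ∙ A₂ ∙ B₂) (W₂ ∙ S₂)
    pair₂ = pairᵍ[ τ ]

    k₂ : Hom (W₂ ∙ S₂) (W₁.Cl ∙ W₁.E*)
    k₂ = reindex-cmp Sᵍ ρ₂ refl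

    C₂ : Ty (W₂ ∙ S₂)
    C₂ = EC [ W₁.eval ∘ k₂ ]

    opaque
      l₂-square : (pr Aᵍ ∘ pr Bᵍ) ∘ q₂ τ Aᵍ Bᵍ ≡ ρ₁ ∘ (ρ₂ ∘ (pr A₂ ∘ pr B₂))
      l₂-square = trans (proj₁ (q₂-pb τ Aᵍ Bᵍ)) assoc

    l₂ : Hom (W₂ ∙ A₂ ∙ B₂) (W₁.Cl ∙ A₁ ∙ B₁)
    l₂ = pb-universal (q₂-pb ρ₁ Aᵍ Bᵍ) (q₂ τ Aᵍ Bᵍ) (ρ₂ ∘ (pr A₂ ∘ pr B₂)) l₂-square

    pr₂∘l₂ : (pr A₁ ∘ pr B₁) ∘ l₂ ≡ ρ₂ ∘ (pr A₂ ∘ pr B₂)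
    pr₂∘l₂ = p₂∘pb-universal (q₂-pb ρ₁ Aᵍ Bᵍ) l₂-square

    pair₁∘l₂ : pair₁ ∘ l₂ ≡ k₂ ∘ pair₂
    pair₁∘l₂ = pairᵍ[]∘≡ ρ₁
      (begin
        pairᵍ ∘ (q₂ ρ₁ Aᵍ Bᵍ ∘ l₂)    ≡⟨ cong (pairᵍ ∘_) (p₁∘pb-universal (q₂-pb ρ₁ Aᵍ Bᵍ) l₂-square) ⟩
        pairᵍ ∘ q₂ τ Aᵍ Bᵍ            ≡⟨ sym (q∘pairᵍ[] τ) ⟩
        q τ Sᵍ ∘ pair₂                ≡⟨ sym (pullˡ (q∘reindex-cmp Sᵍ ρ₂ refl)) ⟩
        q ρ₁ Sᵍ ∘ (k₂ ∘ pair₂)        ∎)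
      (begin
        (pr A₁ ∘ pr B₁) ∘ l₂          ≡⟨ pr₂∘l₂ ⟩
        ρ₂ ∘ (pr A₂ ∘ pr B₂)          ≡⟨ cong (ρ₂ ∘_) (sym (pr∘pairᵍ[] τ)) ⟩
        ρ₂ ∘ (pr S₂ ∘ pair₂)          ≡⟨ sym (extendʳ (pr∘reindex-cmp Sᵍ ρ₂ refl)) ⟩
        pr W₁.E* ∘ (k₂ ∘ pair₂)       ∎)

    mD : Hom (W₂ ∙ A₂ ∙ B₂) D₃.P'
    mD = pb-universal D₃.e-pb (pr A₂ ∘ pr B₂) l₂ (sym pr₂∘l₂)

    dᵍ-map : Hom (W₂ ∙ A₂ ∙ B₂) (VC ∙ EC)
    dᵍ-map = qC₁ ∘ (D₃.ev ∘ mD)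

    qC₂ : Hom (W₂ ∙ S₂ ∙ C₂) (VC ∙ EC)
    qC₂ = q (W₁.eval ∘ k₂) EC

    opaque
      dᵍ-square : pr EC ∘ dᵍ-map ≡ ((W₁.eval ∘ k₂) ∘ pair₂) ∘ id
      dᵍ-square = begin
        pr EC ∘ (qC₁ ∘ (D₃.ev ∘ mD))                    ≡⟨ extendʳ (proj₁ qC₁-pb) ⟩
        (W₁.eval ∘ pair₁) ∘ (pr (C₁ [ pair₁ ]) ∘ (D₃.ev ∘ mD))
                                                        ≡⟨ cong ((W₁.eval ∘ pair₁) ∘_) (pullˡ D₃.ev-over) ⟩
        (W₁.eval ∘ pair₁) ∘ (D₃.e₂ ∘ mD)                ≡⟨ cong ((W₁.eval ∘ pair₁) ∘_) (p₂∘pb-universal D₃.e-pb (sym pr₂∘l₂)) ⟩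
        (W₁.eval ∘ pair₁) ∘ l₂                          ≡⟨ pullʳ pair₁∘l₂ ⟩
        W₁.eval ∘ (k₂ ∘ pair₂)                          ≡⟨ sym assoc ⟩
        (W₁.eval ∘ k₂) ∘ pair₂                          ≡⟨ sym identityʳ ⟩
        ((W₁.eval ∘ k₂) ∘ pair₂) ∘ id                   ∎

      C₂-pb : IsPullback (pr EC) ((W₁.eval ∘ k₂) ∘ pair₂) (qC₂ ∘ q pair₂ C₂) (pr (C₂ [ pair₂ ]))
      C₂-pb = pb-paste (q-pb (W₁.eval ∘ k₂) EC) (q-pb pair₂ C₂)

      dᵍ : U.Sec (C₂ [ pair₂ ])
      dᵍ = pb-universal C₂-pb dᵍ-map id dᵍ-square , p₂∘pb-universal C₂-pb dᵍ-square

      q∘dᵍ : (qC₂ ∘ q pair₂ C₂) ∘ proj₁ dᵍ ≡ dᵍ-map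
      q∘dᵍ = p₁∘pb-universal C₂-pb dᵍ-square

    sᵍ-with-β : Σ (U.Sec C₂) (λ s → proj₁ s ∘ pair₂ ≡ q pair₂ C₂ ∘ proj₁ dᵍ)
    sᵍ-with-β = proj₂ (pairᵍ[]-is-sum τ) C₂ dᵍ

    sᵍ : Hom (W₂ ∙ S₂) (W₂ ∙ S₂ ∙ C₂)
    sᵍ = proj₁ (proj₁ sᵍ-with-β)

    sᵍ-section : pr C₂ ∘ sᵍ ≡ id
    sᵍ-section = proj₂ (proj₁ sᵍ-with-β)

    sᵍ-β : sᵍ ∘ pair₂ ≡ q pair₂ C₂ ∘ proj₁ dᵍ
    sᵍ-β = proj₂ sᵍ-with-β

    module Split {Γ} {nA : Hom Γ VA} {nB : Hom (Γ ∙ EA [ nA ]) VB} {n : Hom Γ Cl}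
                 (rep : Represents nA nB n) {nC : Hom (Γ ∙ Sᵍ [ n ]) VC}
                 (d : K.Sec (reindex! 𝒞 (VC , EC , nC) (Pair.pair rep))) where
      open Pair rep

      nW₁ : Hom Γ W₁.Cl
      nW₁ = W₁.classify n nC

      repW₁ : W₁.Represents n nC nW₁
      repW₁ = W₁.classify-represents n nC

      kΓ : Hom (Γ ∙ Sᵍ [ n ]) (W₁.Cl ∙ W₁.E*)
      kΓ = reindex-cmp Sᵍ nW₁ (proj₁ repW₁)

      lΓ : Hom (Γ ∙ EA [ nA ] ∙ EB [ nB ]) (W₁.Cl ∙ A₁ ∙ B₁)
      lΓ = c-via nW₁ (proj₁ repW₁)

      lΓ-pb : IsPullback nW₁ (pr A₁ ∘ pr B₁) prAB lΓ
      lΓ-pb = c-via-pb nW₁ (proj₁ repW₁)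

      dv : Hom (Γ ∙ EA [ nA ] ∙ EB [ nB ]) (VC ∙ EC)
      dv = q (nC ∘ pair) EC ∘ proj₁ d

      opaque
        hD-square : pr EC ∘ dv ≡ (W₁.eval ∘ pair₁) ∘ lΓ
        hD-square = begin
          pr EC ∘ (q (nC ∘ pair) EC ∘ proj₁ d)            ≡⟨ extendʳ (proj₁ (q-pb (nC ∘ pair) EC)) ⟩
          (nC ∘ pair) ∘ (pr (EC [ nC ∘ pair ]) ∘ proj₁ d) ≡⟨ cong ((nC ∘ pair) ∘_) (proj₂ d) ⟩
          (nC ∘ pair) ∘ id                                ≡⟨ identityʳ ⟩
          nC ∘ pair                                       ≡⟨ cong (_∘ pair) (sym (W₁.eval∘reindex-cmp repW₁)) ⟩
          (W₁.eval ∘ kΓ) ∘ pair                           ≡⟨ pullʳ (sym (pairᵍ[]∘c-via nW₁ (proj₁ repW₁))) ⟩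
          W₁.eval ∘ (pair₁ ∘ lΓ)                          ≡⟨ sym assoc ⟩
          (W₁.eval ∘ pair₁) ∘ lΓ                          ∎

      hD : Hom (Γ ∙ EA [ nA ] ∙ EB [ nB ]) (W₁.Cl ∙ A₁ ∙ B₁ ∙ C₁ [ pair₁ ])
      hD = pb-universal qC₁-pb dv lΓ hD-square

      representation₂ : Unique (Hom Γ W₂) (Classifies D₃ nW₁ prAB lΓ hD)
      representation₂ = D₃.universal nW₁ prAB lΓ lΓ-pb hD (p₂∘pb-universal qC₁-pb hD-square)

      nW₂ : Hom Γ W₂
      nW₂ = witness representation₂

      repW₂ : Classifies D₃ nW₁ prAB lΓ hD nW₂
      repW₂ = has representation₂

      τ∘nW₂ : τ ∘ nW₂ ≡ n
      τ∘nW₂ = trans assoc (trans (cong (ρ₁ ∘_) (proj₁ repW₂)) (proj₁ repW₁))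

      kS : Hom (Γ ∙ Sᵍ [ n ]) (W₂ ∙ S₂)
      kS = reindex-cmp Sᵍ nW₂ τ∘nW₂

      k₂∘kS : k₂ ∘ kS ≡ kΓ
      k₂∘kS = reindex-cmp-comp Sᵍ refl τ∘nW₂ (proj₁ repW₁) (proj₁ repW₂)

      opaque
        split-square : pr EC ∘ (qC₂ ∘ (sᵍ ∘ kS)) ≡ nC ∘ id
        split-square = begin
          pr EC ∘ (qC₂ ∘ (sᵍ ∘ kS))              ≡⟨ extendʳ (proj₁ (q-pb (W₁.eval ∘ k₂) EC)) ⟩
          (W₁.eval ∘ k₂) ∘ (pr C₂ ∘ (sᵍ ∘ kS))   ≡⟨ cong ((W₁.eval ∘ k₂) ∘_) (trans (pullˡ sᵍ-section) identityˡ) ⟩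
          (W₁.eval ∘ k₂) ∘ kS                    ≡⟨ pullʳ k₂∘kS ⟩
          W₁.eval ∘ kΓ                           ≡⟨ W₁.eval∘reindex-cmp repW₁ ⟩
          nC                                     ≡⟨ sym identityʳ ⟩
          nC ∘ id                                ∎

        split : K.Sec (VC , EC , nC)
        split = pb-universal (q-pb nC EC) (qC₂ ∘ (sᵍ ∘ kS)) id split-square , p₂∘pb-universal (q-pb nC EC) split-square

        q∘split : q nC EC ∘ proj₁ split ≡ qC₂ ∘ (sᵍ ∘ kS)
        q∘split = p₁∘pb-universal (q-pb nC EC) split-square

        split-unique : ∀ {u : Hom (Γ ∙ Sᵍ [ n ]) (Γ ∙ Sᵍ [ n ] ∙ EC [ nC ])}
                     → q nC EC ∘ u ≡ qC₂ ∘ (sᵍ ∘ kS) → pr (EC [ nC ]) ∘ u ≡ id → u ≡ proj₁ split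
        split-unique = pb-universal-unique (q-pb nC EC) split-square _

      j : Hom (Γ ∙ EA [ nA ] ∙ EB [ nB ]) (W₂ ∙ A₂ ∙ B₂)
      j = c-via nW₂ τ∘nW₂

      l₂∘j : l₂ ∘ j ≡ lΓ
      l₂∘j = pb-universal-unique (q₂-pb ρ₁ Aᵍ Bᵍ) (c-via-square nW₁ (proj₁ repW₁)) (l₂ ∘ j)
        (trans (pullˡ (p₁∘pb-universal (q₂-pb ρ₁ Aᵍ Bᵍ) l₂-square)) (q₂∘c-via nW₂ τ∘nW₂))
        (begin
          (pr A₁ ∘ pr B₁) ∘ (l₂ ∘ j)    ≡⟨ pullˡ pr₂∘l₂ ⟩
          (ρ₂ ∘ (pr A₂ ∘ pr B₂)) ∘ j    ≡⟨ pullʳ (pr₂∘c-via nW₂ τ∘nW₂) ⟩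
          ρ₂ ∘ (nW₂ ∘ prAB)             ≡⟨ sym assoc ⟩
          (ρ₂ ∘ nW₂) ∘ prAB             ≡⟨ cong (_∘ prAB) (proj₁ repW₂) ⟩
          nW₁ ∘ prAB                    ∎)

      ev∘mD∘j : D₃.ev ∘ (mD ∘ j) ≡ hD
      ev∘mD∘j = proj₂ repW₂ (mD ∘ j)
        (trans (pullˡ (p₁∘pb-universal D₃.e-pb (sym pr₂∘l₂))) (pr₂∘c-via nW₂ τ∘nW₂))
        (trans (pullˡ (p₂∘pb-universal D₃.e-pb (sym pr₂∘l₂))) l₂∘j)

      dᵍ-map∘j : dᵍ-map ∘ j ≡ dv
      dᵍ-map∘j = trans (pullʳ (trans assoc ev∘mD∘j)) (p₁∘pb-universal qC₁-pb hD-square)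

      split-β : proj₁ split ∘ pair ≡ q! 𝒞 pair (VC , EC , nC) ∘ proj₁ d
      split-β = pb-jointly-monic (q-pb nC EC) _ _
        (begin
          q nC EC ∘ (proj₁ split ∘ pair)                 ≡⟨ pullˡ q∘split ⟩
          (qC₂ ∘ (sᵍ ∘ kS)) ∘ pair                        ≡⟨ pullʳ (pullʳ (sym (pairᵍ[]∘c-via nW₂ τ∘nW₂))) ⟩
          qC₂ ∘ (sᵍ ∘ (pair₂ ∘ j))                        ≡⟨ cong (qC₂ ∘_) (pullˡ sᵍ-β) ⟩
          qC₂ ∘ ((q pair₂ C₂ ∘ proj₁ dᵍ) ∘ j)             ≡⟨ cong (qC₂ ∘_) assoc ⟩
          qC₂ ∘ (q pair₂ C₂ ∘ (proj₁ dᵍ ∘ j))             ≡⟨ sym assoc ⟩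
          (qC₂ ∘ q pair₂ C₂) ∘ (proj₁ dᵍ ∘ j)             ≡⟨ pullˡ q∘dᵍ ⟩
          dᵍ-map ∘ j                                      ≡⟨ dᵍ-map∘j ⟩
          q (nC ∘ pair) EC ∘ proj₁ d                      ≡⟨ sym (pullˡ (q∘q! pair EC nC)) ⟩
          q nC EC ∘ (q! 𝒞 pair (VC , EC , nC) ∘ proj₁ d) ∎)
        (begin
          pr (EC [ nC ]) ∘ (proj₁ split ∘ pair)                  ≡⟨ pullˡ (proj₂ split) ⟩
          id ∘ pair                                              ≡⟨ identityˡ ⟩
          pair                                                   ≡⟨ sym identityʳ ⟩
          pair ∘ id                                              ≡⟨ cong (pair ∘_) (sym (proj₂ d)) ⟩
          pair ∘ (pr (EC [ nC ∘ pair ]) ∘ proj₁ d)               ≡⟨ sym (extendʳ (pr∘q! pair EC nC)) ⟩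
          pr (EC [ nC ]) ∘ (q! 𝒞 pair (VC , EC , nC) ∘ proj₁ d)  ∎)

    module Split-∘ {Δ Γ} (σ : Hom Δ Γ) {nA : Hom Γ VA} {nB : Hom (Γ ∙ EA [ nA ]) VB} {n : Hom Γ Cl}
                   (rep : Represents nA nB n)
                   (rep′ : Represents (nA ∘ σ) (nB ∘ q! 𝒞 σ (VA , EA , nA)) (n ∘ σ))
                   {nC : Hom (Γ ∙ Sᵍ [ n ]) VC}
                   (d : K.Sec (reindex! 𝒞 (VC , EC , nC) (Pair.pair rep)))
                   (d′ : K.Sec (reindex! 𝒞 (VC , EC , nC ∘ q! 𝒞 σ (Sᵍ! n)) (Pair.pair rep′)))
                   (dv-∘ : Split.dv rep d ∘ Pair-∘.qAB σ rep rep′ ≡ Split.dv rep′ d′) where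
      open Pair-∘ σ rep rep′
      private
        module S = Split rep d
        module S′ = Split rep′ d′

      qS : Hom (Δ ∙ Sᵍ [ n ∘ σ ]) (Γ ∙ Sᵍ [ n ])
      qS = q! 𝒞 σ (Sᵍ! n)

      nW₁-∘ : S.nW₁ ∘ σ ≡ S′.nW₁
      nW₁-∘ = W₁.classify-∘ n nC σ

      lΓ-∘ : S.lΓ ∘ qAB ≡ S′.lΓ
      lΓ-∘ = c-via-∘ (proj₁ S.repW₁) (proj₁ S′.repW₁) nW₁-∘

      hD-∘ : S.hD ∘ qAB ≡ S′.hD
      hD-∘ = pb-universal-∘ qC₁-pb S.hD-square qAB S′.hD-square dv-∘ lΓ-∘

      nW₂-∘ : S.nW₂ ∘ σ ≡ S′.nW₂
      nW₂-∘ = unique S′.representation₂ (S.nW₂ ∘ σ)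
        (Classifies-∘ D₃ (proj₁ S.lΓ-pb) S.repW₂ σ qAB nW₁-∘ prAB∘qAB lΓ-∘ hD-∘)

      kS-∘ : S.kS ∘ qS ≡ S′.kS
      kS-∘ = reindex-cmp-∘ Sᵍ S.τ∘nW₂ σ S′.τ∘nW₂ nW₂-∘

      split-∘ : S′.split ≡ K.reindex-sec {A = VC , EC , nC} qS S.split
      split-∘ = K!.Sec-≡ (sym (S′.split-unique
        (begin
          q (nC ∘ qS) EC ∘ proj₁ rs                      ≡⟨ cong (_∘ proj₁ rs) (sym (q∘q! qS EC nC)) ⟩
          (q nC EC ∘ q! 𝒞 qS (VC , EC , nC)) ∘ proj₁ rs  ≡⟨ pullʳ (K!.q∘reindex-sec qS S.split) ⟩
          q nC EC ∘ (proj₁ S.split ∘ qS)                 ≡⟨ pullˡ S.q∘split ⟩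
          (qC₂ ∘ (sᵍ ∘ S.kS)) ∘ qS                        ≡⟨ pullʳ (pullʳ kS-∘) ⟩
          qC₂ ∘ (sᵍ ∘ S′.kS)                              ∎)
        (proj₂ rs)))
        where
        rs = K.reindex-sec {A = VC , EC , nC} qS S.split

  module GP = GenericPair
  module GS = GenericSplit

  split-at : ∀ {Γ VA VB} {EA : Ty VA} {EB : Ty VB} {nA : Hom Γ VA} {nB : Hom (Γ ∙ EA [ nA ]) VB}
               {n : Hom Γ (GP.Cl EA EB)} (rep : GP.Represents EA EB nA nB n)
               (X : Ty! 𝒞 (Γ ∙ GP.Sᵍ EA EB [ n ]))
             → K.Sec (reindex! 𝒞 X (GP.Pair.pair EA EB rep)) → K.Sec X
  split-at {EA = EA} {EB} rep (_ , EC , _) d = GS.Split.split EA EB EC rep d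

  split-at-stable :
    ∀ {Δ Γ VA VB} (σ : Hom Δ Γ) {EA : Ty VA} {EB : Ty VB} {nA : Hom Γ VA}
      {nB : Hom (Γ ∙ EA [ nA ]) VB} {n : Hom Γ (GP.Cl EA EB)} (rep : GP.Represents EA EB nA nB n)
      (X : Ty! 𝒞 (Γ ∙ GP.Sᵍ EA EB [ n ])) (d : K.Sec (reindex! 𝒞 X (GP.Pair.pair EA EB rep)))
      {n′ : Hom Δ (GP.Cl EA EB)}
      (rep′ : GP.Represents EA EB (nA ∘ σ) (nB ∘ q! 𝒞 σ (VA , EA , nA)) n′) (p : n ∘ σ ≡ n′)
    → let C′ = subst (λ Y → Ty! 𝒞 (Δ ∙ ⟦ Y ⟧)) (cong (GP.Sᵍ! EA EB) p)
                     (reindex! 𝒞 X (q! 𝒞 σ (GP.Sᵍ! EA EB n)))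
      in (e : reindex! 𝒞 (reindex! 𝒞 X (GP.Pair.pair EA EB rep)) (q! 𝒞 (q! 𝒞 σ (VA , EA , nA)) (VB , EB , nB))
              ≡ reindex! 𝒞 C′ (GP.Pair.pair EA EB rep′))
    → split-at rep′ C′ (subst K.Sec e (K.reindex-sec (q! 𝒞 (q! 𝒞 σ (VA , EA , nA)) (VB , EB , nB)) d))
      ≡ K.transport-sec (cong (GP.Sᵍ! EA EB) p) (reindex! 𝒞 X (q! 𝒞 σ (GP.Sᵍ! EA EB n)))
          (K.reindex-sec (q! 𝒞 σ (GP.Sᵍ! EA EB n)) (split-at rep X d))
  split-at-stable σ {EA} {EB} {n = n} rep (VC , EC , nC) d rep′ refl e =
    GS.Split-∘.split-∘ EA EB EC σ rep rep′ d (subst K.Sec e rd) dv-∘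
    where
    open GP.Pair-∘ EA EB σ rep rep′ using (qAB)
    pair = GP.Pair.pair EA EB rep
    pair′ = GP.Pair.pair EA EB rep′
    qS = q! 𝒞 σ (GP.Sᵍ! EA EB n)
    rd = K.reindex-sec qAB d
    dv-∘ : GS.Split.dv EA EB EC rep d ∘ qAB ≡ GS.Split.dv EA EB EC rep′ (subst K.Sec e rd)
    dv-∘ = begin
      (q (nC ∘ pair) EC ∘ proj₁ d) ∘ qAB                            ≡⟨ pullʳ (sym (K!.q∘reindex-sec qAB d)) ⟩
      q (nC ∘ pair) EC ∘ (q! 𝒞 qAB (VC , EC , nC ∘ pair) ∘ proj₁ rd) ≡⟨ pullˡ (q∘q! qAB EC (nC ∘ pair)) ⟩
      q ((nC ∘ pair) ∘ qAB) EC ∘ proj₁ rd                            ≡⟨ sym (q∘subst-Sec e rd) ⟩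
      q ((nC ∘ qS) ∘ pair′) EC ∘ proj₁ (subst K.Sec e rd)             ∎

  Sig! : ∀ {Γ} (A : Ty! 𝒞 Γ) → Ty! 𝒞 (Γ ∙ ⟦ A ⟧) → Ty! 𝒞 Γ
  Sig! (_ , EA , nA) (_ , EB , nB) = GP.Sᵍ! EA EB (GP.classify EA EB nA nB)

  pair! : ∀ {Γ} (A : Ty! 𝒞 Γ) (B : Ty! 𝒞 (Γ ∙ ⟦ A ⟧)) → Hom (Γ ∙ ⟦ A ⟧ ∙ ⟦ B ⟧) (Γ ∙ ⟦ Sig! A B ⟧)
  pair! (_ , EA , nA) (_ , EB , nB) = GP.Pair.pair EA EB (GP.classify-represents EA EB nA nB)

  strictly-stable-sums : K.StrictlyStableSums
  strictly-stable-sums = record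
    { Sig          = Sig!
    ; pair         = pair!
    ; pair-over    = λ { (_ , EA , nA) (_ , EB , nB) →
                         GP.Pair.pr∘pair EA EB (GP.classify-represents EA EB nA nB) }
    ; split        = λ { (_ , EA , nA) (_ , EB , nB) → split-at (GP.classify-represents EA EB nA nB) }
    ; split-β      = λ { (_ , EA , nA) (_ , EB , nB) (_ , EC , _) d →
                         GS.Split.split-β EA EB EC (GP.classify-represents EA EB nA nB) d }
    ; Sig-stable   = λ { σ (_ , EA , nA) (_ , EB , nB) → cong (GP.Sᵍ! EA EB) (GP.classify-∘ EA EB nA nB σ) }
    ; pair-stable  = λ { σ (VA , EA , nA) (_ , EB , nB) →
                         GP.pair-stable EA EB σ (GP.classify-represents EA EB nA nB)
                           (GP.classify-represents EA EB (nA ∘ σ) (nB ∘ q! 𝒞 σ (VA , EA , nA)))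
                           (GP.classify-∘ EA EB nA nB σ) }
    ; split-stable = λ { σ (VA , EA , nA) (_ , EB , nB) X d →
                         split-at-stable σ (GP.classify-represents EA EB nA nB) X d
                           (GP.classify-represents EA EB (nA ∘ σ) (nB ∘ q! 𝒞 σ (VA , EA , nA)))
                           (GP.classify-∘ EA EB nA nB σ) }
    }

lemma3p4p4p2 : ∀ {o ℓ t h} (𝒞 : FullComprehensionCategory o ℓ t h)
    → StructureNotions.LF (underlying 𝒞)
    → StructureNotions.HasWeaklyStableSums (underlying 𝒞)
    → StructureNotions.StrictlyStableSums (𝒞 !)
lemma3p4p4p2 𝒞 lf wss = SplitSums.strictly-stable-sums 𝒞 lf wss
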